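{- Let $G=(V,E)$ be a vertex-labeled digraph defined by a directed clique-width $k$-expression $X$, let $a,b\in\{1,\dots,k\}$ with $a\neq b$, let $V'\subseteq V$ be an acyclic set in $G$, and assume $(b,a)\notin\mathrm{reach}(V')$ (computed in $G$). Then $\mathrm{reach}(V')$ computed in the digraph defined by $\alpha_{a,b}(X)$ equals the set obtained from $\mathrm{reach}(V')$ computed in $G$ by adding, for every pair $(x,a)\in\mathrm{reach}(V')$ and every pair $(b,y)\in\mathrm{reach}(V')$, the pair $(x,y)$.
   Context: A directed clique-width $k$-expression is an expression built with labels $\{1,\dots,k\}$ from the operations: $a(v)$, creating a vertex $v$ with label $a$; $G\oplus H$, disjoint union of labeled digraphs; $\alpha_{a,b}$ ($a\neq b$), adding an arc from every vertex with label $a$ to every vertex with label $b$; $\rho_{a\to b}$, changing every label $a$ into label $b$. A set $V'\subseteq V$ is acyclic if the induced subdigraph on $V'$ has no directed cycle. For $V'\subseteq V$ in a labeled digraph $H$, $\mathrm{reach}(V')$ is the set of all label pairs $(c,d)$ such that there exist $u\in V'$ with label $c$ and $v\in V'$ with label $d$ with $v$ reachable from $u$ by a directed path in $H[V']$ (including $v=u$). -}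

module Defs where

open import Data.Nat using (ℕ)
open import Data.Fin using (Fin; _≟_)
open import Data.Unit using (⊤; tt)
open import Data.Empty using (⊥)
open import Data.Sum using (_⊎_; inj₁; inj₂)
open import Data.Product using (_×_; ∃-syntax)
open import Relation.Nullary using (¬_; yes; no)
open import Relation.Binary.PropositionalEquality using (_≡_; _≢_)

data Expr (k : ℕ) : Set where
  vtx  : Fin k → Expr k
  _⊕_  : Expr k → Expr k → Expr k
  α    : (a b : Fin k) → a ≢ b → Expr k → Expr k
  ρ    : (a b : Fin k) → Expr k → Expr k

Vtx : ∀ {k} → Expr k → Set
Vtx (vtx _)     = ⊤
Vtx (X ⊕ Y)     = Vtx X ⊎ Vtx Y
Vtx (α _ _ _ X) = Vtx X
Vtx (ρ _ _ X)   = Vtx X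

label : ∀ {k} (X : Expr k) → Vtx X → Fin k
label (vtx a)     _        = a
label (X ⊕ Y)     (inj₁ u) = label X u
label (X ⊕ Y)     (inj₂ u) = label Y u
label (α _ _ _ X) u        = label X u
label (ρ a b X)   u with label X u ≟ a
... | yes _ = b
... | no  _ = label X u

Arc : ∀ {k} (X : Expr k) → Vtx X → Vtx X → Set
Arc (vtx _)     _        _        = ⊥
Arc (X ⊕ Y)     (inj₁ u) (inj₁ v) = Arc X u v
Arc (X ⊕ Y)     (inj₁ _) (inj₂ _) = ⊥
Arc (X ⊕ Y)     (inj₂ _) (inj₁ _) = ⊥
Arc (X ⊕ Y)     (inj₂ u) (inj₂ v) = Arc Y u v
Arc (α a b _ X) u        v        = Arc X u v ⊎ (label X u ≡ a × label X v ≡ b)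
Arc (ρ _ _ X)   u        v        = Arc X u v

data Path {k} (X : Expr k) (S : Vtx X → Set) : Vtx X → Vtx X → Set where
  here : ∀ {u} → S u → Path X S u u
  step : ∀ {u w v} → S u → Arc X u w → Path X S w v → Path X S u v

Acyclic : ∀ {k} (X : Expr k) → (Vtx X → Set) → Set
Acyclic X S = ¬ (∃[ u ] ∃[ w ] (S u × Arc X u w × Path X S w u))

Reach : ∀ {k} (X : Expr k) → (Vtx X → Set) → Fin k → Fin k → Set
Reach X S c d =
  ∃[ u ] ∃[ v ] (S u × S v × label X u ≡ c × label X v ≡ d × Path X S u v)

-- A path of α_{a,b}(X) inside S uses at most one of the new arcs a → b: the part of the
-- path after a new arc starts at a vertex labelled b, so a second new arc, which leaves a
-- vertex labelled a, would be preceded by a path of X witnessing (b , a) ∈ reach(S).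
-- Hence every such path is either a path of X, or a path of X to a vertex labelled a,
-- one new arc, and a path of X from a vertex labelled b; conversely every such
-- concatenation is a path of α_{a,b}(X).
module Submission where

open import Defs
open import Data.Nat using (ℕ)
open import Data.Fin using (Fin)
open import Data.Empty using (⊥-elim)
open import Data.Sum using (_⊎_; inj₁; inj₂)
open import Data.Product using (_×_; _,_)
open import Relation.Nullary using (¬_)
open import Relation.Binary.PropositionalEquality using (_≢_; _≡_)
open import Function.Bundles using (_⇔_; mk⇔)

module _ {k : ℕ} {X : Expr k} {S : Vtx X → Set} where

  Path-source : ∀ {u v} → Path X S u v → S u
  Path-source (here s)     = s
  Path-source (step s _ _) = s

  Path-target : ∀ {u v} → Path X S u v → S v
  Path-target (here s)     = s
  Path-target (step _ _ p) = Path-target p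

  _++_ : ∀ {u w v} → Path X S u w → Path X S w v → Path X S u v
  here _     ++ q = q
  step s r p ++ q = step s r (p ++ q)

  path⇒reach : ∀ {u v c d} → label X u ≡ c → label X v ≡ d → Path X S u v → Reach X S c d
  path⇒reach {u} {v} lu lv p = u , v , Path-source p , Path-target p , lu , lv , p

module _ {k : ℕ} {X : Expr k} {a b : Fin k} {a≢b : a ≢ b} {S : Vtx X → Set} where

  private
    Xab = α a b a≢b X

  Path-α⁺ : ∀ {u v} → Path X S u v → Path Xab S u v
  Path-α⁺ (here s)     = here s
  Path-α⁺ (step s r p) = step s (inj₁ r) (Path-α⁺ p)

  data SplitPath (u v : Vtx X) : Set where
    old : Path X S u v → SplitPath u v
    new : ∀ {w w'} → label X w ≡ a → label X w' ≡ b →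
          Path X S u w → Path X S w' v → SplitPath u v

  SplitPath⇒Path : ∀ {u v} → SplitPath u v → Path Xab S u v
  SplitPath⇒Path (old p) = Path-α⁺ p
  SplitPath⇒Path (new la lb p q) =
    Path-α⁺ p ++ step (Path-target p) (inj₂ (la , lb)) (Path-α⁺ q)

  Path⇒SplitPath : ¬ Reach X S b a → ∀ {u v} → Path Xab S u v → SplitPath u v
  Path⇒SplitPath _  (here s) = old (here s)
  Path⇒SplitPath ¬ba (step s (inj₁ r) p) with Path⇒SplitPath ¬ba p
  ... | old q           = old (step s r q)
  ... | new la lb q₁ q₂ = new la lb (step s r q₁) q₂
  Path⇒SplitPath ¬ba (step s (inj₂ (la , lb)) p) with Path⇒SplitPath ¬ba p
  ... | old q          = new la lb (here s) q
  ... | new la' _ q₁ _ = ⊥-elim (¬ba (path⇒reach lb la' q₁))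

lemma4p9 : (k : ℕ) (X : Expr k) (a b : Fin k) (a≢b : a ≢ b) (S : Vtx X → Set) →
    Acyclic X S → ¬ Reach X S b a →
    (x y : Fin k) →
    Reach (α a b a≢b X) S x y ⇔ (Reach X S x y ⊎ (Reach X S x a × Reach X S b y))
lemma4p9 k X a b a≢b S _ ¬ba x y = mk⇔ to from
  where
  to : Reach (α a b a≢b X) S x y → Reach X S x y ⊎ (Reach X S x a × Reach X S b y)
  to (_ , _ , _ , _ , lx , ly , p) with Path⇒SplitPath ¬ba p
  ... | old q           = inj₁ (path⇒reach lx ly q)
  ... | new la lb q₁ q₂ = inj₂ (path⇒reach lx la q₁ , path⇒reach lb ly q₂)

  from : Reach X S x y ⊎ (Reach X S x a × Reach X S b y) → Reach (α a b a≢b X) S x y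
  from (inj₁ (u , v , su , sv , lx , ly , q)) =
    u , v , su , sv , lx , ly , SplitPath⇒Path {a≢b = a≢b} (old q)
  from (inj₂ ((u , _ , su , _ , lx , la , q₁) , (_ , v , _ , sv , lb , ly , q₂))) =
    u , v , su , sv , lx , ly , SplitPath⇒Path {a≢b = a≢b} (new la lb q₁ q₂)
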